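{- There exists a 0-1-symmetric language $L\subseteq\{0,1\}^*$ such that every graph $G=(V,E)$ with $|V|=n$ and $|E|=m$ can be represented as $G=G(L,w)$ for a word $w\in V^*$ of length $\mathcal{O}(n+m)$; in particular, $w$ can be encoded as a binary string of size $\mathcal{O}((n+m)\log n)$.
   Context: All graphs are finite, simple, undirected, with nonempty vertex sets. For $w\in\{0,1\}^*$ let $\widetilde{w}$ be obtained from $w$ by exchanging the letters 0 and 1; a language $L\subseteq\{0,1\}^*$ is 0-1-symmetric if $L=\{\widetilde w : w\in L\}$. For an alphabet $V$ and distinct $u,v\in V$, $h_{u,v}:V^*\to\{0,1\}^*$ is the monoid morphism with $u\mapsto 0$, $v\mapsto 1$ and $x\mapsto\lambda$ (empty word) for all other letters $x$. For a 0-1-symmetric $L$ and a nonempty word $w$ whose set of occurring letters is $V$, $G(L,w)$ is the graph with vertex set $V$ in which distinct $u,v$ are adjacent iff $h_{u,v}(w)\in L$. The constant in $\mathcal{O}$ is independent of the graph. -}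

module Defs where

open import Data.Bool using (Bool; true; false; not; _∧_; if_then_else_)
open import Data.Nat using (ℕ; zero; suc; _+_; _<ᵇ_)
open import Data.Fin using (Fin; toℕ; _≟_)
open import Data.List using (List; []; _∷_; map; mapMaybe; allFin; concatMap)
open import Data.Nat.ListAction using (sum)
open import Data.Maybe using (Maybe; just; nothing)
open import Data.Product using (_×_)
open import Relation.Nullary using (¬_; yes; no)
open import Relation.Binary.PropositionalEquality using (_≡_)
open import Function.Bundles using (_⇔_)

-- A language over {0,1}: a predicate on binary words (0 = false, 1 = true).
Language : Set₁
Language = List Bool → Set

swap01 : List Bool → List Bool
swap01 = map not

-- L is 0-1-symmetric: L = { w~ : w ∈ L }  (since ~ is an involution,
-- this is equivalent to: w ∈ L ⇔ w~ ∈ L for all w)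
Symmetric01 : Language → Set
Symmetric01 L = ∀ w → L w ⇔ L (swap01 w)

h : ∀ {n} → Fin n → Fin n → List (Fin n) → List Bool
h u v = mapMaybe f
  where
  f : _ → Maybe Bool
  f x with x ≟ u
  ... | yes _ = just false
  ... | no _ with x ≟ v
  ...   | yes _ = just true
  ...   | no _ = nothing

IsSimpleGraph : ∀ {n} → (Fin n → Fin n → Bool) → Set
IsSimpleGraph {n} adj = (∀ u v → adj u v ≡ adj v u) × (∀ u → adj u u ≡ false)

edgeCount : ∀ n → (Fin n → Fin n → Bool) → ℕ
edgeCount n adj =
  sum (concatMap (λ u → map (λ v → if (toℕ u <ᵇ toℕ v) ∧ adj u v then 1 else 0)
                            (allFin n))
                 (allFin n))

data _occursIn_ {A : Set} (x : A) : List A → Set where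
  here  : ∀ {xs} → x occursIn (x ∷ xs)
  there : ∀ {y xs} → x occursIn xs → x occursIn (y ∷ xs)

Represents : ∀ {n} → Language → List (Fin n) → (Fin n → Fin n → Bool) → Set
Represents {n} L w adj =
  (∀ (v : Fin n) → v occursIn w) ×
  (∀ (u v : Fin n) → ¬ (u ≡ v) → (adj u v ≡ true) ⇔ L (h u v w))

-- Order the vertices and let w be the concatenation, in increasing order of u, of the blocks
-- u · (the neighbours v > u of u) · u; then |w| = 2n + m. For u < v the image h_{u,v}(w) has the
-- shape x 0 a 0 z: the two 0s come from the block of u, a is 1 if uv ∈ E and empty otherwise, and
-- z ∈ 1⁺ because the later blocks avoid u but include the block of v. The 0-1-symmetric language
-- of words ending in b b̄ bᵏ (k ≥ 1) accepts x 0 1 0 1⁺ and rejects x 0 0 1⁺, and the case v < u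
-- follows from h_{u,v}(w) = ~h_{v,u}(w).
module Submission where

open import Defs
open import Data.Bool using (Bool; true; false; not; _xor_; _∧_; if_then_else_; T)
open import Data.Bool.Properties using (not-involutive; T-∧; T-≡)
open import Data.Fin using (Fin; zero; suc; toℕ; _≟_; _<_)
open import Data.Fin.Properties using (<-cmp; <-trans; <-asym; <-irrefl; <⇒≢)
open import Data.List
  using (List; []; _∷_; _++_; [_]; map; foldr; catMaybes; length; filterᵇ; allFin; concatMap)
open import Data.List.Properties
  using (length-++; length-tabulate; map-++; ++-assoc; concatMap-++; catMaybes-++; foldr-++; map-tabulate)
open import Data.List.Membership.Propositional using (_∈_)
open import Data.List.Membership.Propositional.Properties
  using (∈-++⁺ʳ; ∈-++⁻; ∈-filter⁺; ∈-allFin; ∈-concatMap⁺)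
open import Data.List.Relation.Unary.All as All using (All; []; _∷_)
open import Data.List.Relation.Unary.All.Properties as AllP using (++⁺)
open import Data.List.Relation.Unary.Any as Any using (here; there)
open import Data.Nat using (ℕ; suc; _+_; _*_; _≤_; z<s; s<s; _<ᵇ_)
open import Data.Nat.Properties using (<ᵇ⇒<; <⇒<ᵇ; +-monoʳ-≤; m≤n*m; *-distribˡ-+; module ≤-Reasoning)
open import Data.Nat.ListAction using (sum)
open import Data.Nat.ListAction.Properties using (sum-++)
open import Data.Nat.Tactic.RingSolver using (solve-∀)
open import Data.Product using (Σ-syntax; _×_; _,_; ∃₂; proj₁; proj₂)
open import Data.Sum using (_⊎_; inj₁; inj₂)
open import Function using (_∘_; id)
open import Function.Bundles using (mk⇔; Equivalence)
open import Relation.Binary.Definitions using (tri<; tri≈; tri>)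
open import Relation.Binary.PropositionalEquality
  using (_≡_; _≢_; refl; sym; trans; cong; cong₂; subst; ≢-sym; module ≡-Reasoning)
open import Relation.Nullary using (yes; no; contradiction)
open import Relation.Nullary.Decidable using (T?)

private
  variable
    n : ℕ
    u v x : Fin n
    xs : List (Fin n)

-- A right-to-left automaton: it reads the final maximal run bᵏ, then the letter b̄ ending it,
-- and accepts iff the next letter is b again.
data Phase : Set where
  start   : Phase
  inRun   : Bool → Phase
  pastRun : Bool → Phase
  decided : Bool → Phase

step : Bool → Phase → Phase
step c start       = inRun c
step c (inRun b)   = if c xor b then pastRun b else inRun b
step c (pastRun b) = decided (not (c xor b))
step c (decided r) = decided r

scan : List Bool → Phase
scan = foldr step start

verdict : Phase → Bool
verdict (decided r) = r
verdict _           = false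

accepts : List Bool → Bool
accepts w = verdict (scan w)

Lang : Language
Lang w = accepts w ≡ true

swapPhase : Phase → Phase
swapPhase start       = start
swapPhase (inRun b)   = inRun (not b)
swapPhase (pastRun b) = pastRun (not b)
swapPhase (decided r) = decided r

not-xor-not : ∀ x y → not x xor not y ≡ x xor y
not-xor-not true  y = refl
not-xor-not false y = not-involutive y

step-swap : ∀ c p → step (not c) (swapPhase p) ≡ swapPhase (step c p)
step-swap c start       = refl
step-swap c (inRun b) rewrite not-xor-not c b with c xor b
... | true  = refl
... | false = refl
step-swap c (pastRun b) rewrite not-xor-not c b = refl
step-swap c (decided r) = refl

scan-swap01 : ∀ w → scan (swap01 w) ≡ swapPhase (scan w)
scan-swap01 []      = refl
scan-swap01 (c ∷ w) = trans (cong (step (not c)) (scan-swap01 w)) (step-swap c (scan w))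

verdict-swapPhase : ∀ p → verdict (swapPhase p) ≡ verdict p
verdict-swapPhase start       = refl
verdict-swapPhase (inRun b)   = refl
verdict-swapPhase (pastRun b) = refl
verdict-swapPhase (decided r) = refl

accepts-swap01 : ∀ w → accepts (swap01 w) ≡ accepts w
accepts-swap01 w = trans (cong verdict (scan-swap01 w)) (verdict-swapPhase (scan w))

Lang-symmetric01 : Symmetric01 Lang
Lang-symmetric01 w = mk⇔ (trans (accepts-swap01 w)) (trans (sym (accepts-swap01 w)))

Ones⁺ : List Bool → Set
Ones⁺ a = All (_≡ true) a × true ∈ a

scan-ones⁺ : ∀ {a} → Ones⁺ a → scan a ≡ inRun true
scan-ones⁺ (refl ∷ []             , _) = refl
scan-ones⁺ (refl ∷ ts@(refl ∷ _) , _) rewrite scan-ones⁺ (ts , here refl) = refl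

pastRun-ones⁺ : ∀ {a} → Ones⁺ a → foldr step (pastRun true) a ≡ decided true
pastRun-ones⁺ (refl ∷ []             , _) = refl
pastRun-ones⁺ (refl ∷ ts@(refl ∷ _) , _) rewrite pastRun-ones⁺ (ts , here refl) = refl

decided-absorbs : ∀ r w → foldr step (decided r) w ≡ decided r
decided-absorbs r []      = refl
decided-absorbs r (c ∷ w) rewrite decided-absorbs r w = refl

accepts-suffix : ∀ x {w r} → scan w ≡ decided r → accepts (x ++ w) ≡ r
accepts-suffix x {w} {r} scan≡ = cong verdict (begin
  foldr step start (x ++ w) ≡⟨ foldr-++ step start x w ⟩
  foldr step (scan w) x     ≡⟨ cong (λ p → foldr step p x) scan≡ ⟩
  foldr step (decided r) x  ≡⟨ decided-absorbs r x ⟩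
  decided r                 ∎)
  where open ≡-Reasoning

accepts-01⁺01⁺ : ∀ x {a z} → Ones⁺ a → Ones⁺ z → accepts (x ++ false ∷ a ++ false ∷ z) ≡ true
accepts-01⁺01⁺ x {a} {z} a∈1⁺ z∈1⁺ = accepts-suffix x (begin
  step false (foldr step start (a ++ false ∷ z))
    ≡⟨ cong (step false) (foldr-++ step start a (false ∷ z)) ⟩
  step false (foldr step (step false (scan z)) a)
    ≡⟨ cong (λ p → step false (foldr step (step false p) a)) (scan-ones⁺ z∈1⁺) ⟩
  step false (foldr step (pastRun true) a)
    ≡⟨ cong (step false) (pastRun-ones⁺ a∈1⁺) ⟩
  decided true ∎)
  where open ≡-Reasoning

rejects-001⁺ : ∀ x {z} → Ones⁺ z → accepts (x ++ false ∷ false ∷ z) ≡ false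
rejects-001⁺ x z∈1⁺ = accepts-suffix x (cong (step false ∘ step false) (scan-ones⁺ z∈1⁺))

h-++ : ∀ (u v : Fin n) xs ys → h u v (xs ++ ys) ≡ h u v xs ++ h u v ys
h-++ u v xs ys = trans (cong catMaybes (map-++ _ xs ys)) (catMaybes-++ (map _ xs) (map _ ys))

h-∷ : ∀ (u v x : Fin n) xs → h u v (x ∷ xs) ≡ h u v [ x ] ++ h u v xs
h-∷ u v x = h-++ u v [ x ]

h-[u] : ∀ (u v : Fin n) → h u v [ u ] ≡ [ false ]
h-[u] u v with u ≟ u
... | yes _  = refl
... | no u≢u = contradiction refl u≢u

h-u∷ : ∀ (u v : Fin n) xs → h u v (u ∷ xs) ≡ false ∷ h u v xs
h-u∷ u v xs = trans (h-∷ u v u xs) (cong (_++ h u v xs) (h-[u] u v))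

h-[v] : u ≢ v → h u v [ v ] ≡ [ true ]
h-[v] {u = u} {v} u≢v with v ≟ u
... | yes v≡u = contradiction (sym v≡u) u≢v
... | no _ with v ≟ v
...   | yes _  = refl
...   | no v≢v = contradiction refl v≢v

h-[x] : x ≢ u → x ≢ v → h u v [ x ] ≡ []
h-[x] {x = x} {u} {v} x≢u x≢v with x ≟ u
... | yes x≡u = contradiction x≡u x≢u
... | no _ with x ≟ v
...   | yes x≡v = contradiction x≡v x≢v
...   | no _    = refl

-- Case analysis through this lemma, rather than `with x ≟ u` directly, keeps the goal
-- (which mentions h, hence x ≟ u) from being abstracted.
letter-cases : ∀ (u v x : Fin n) → x ≡ u ⊎ x ≡ v ⊎ (x ≢ u × x ≢ v)
letter-cases u v x with x ≟ u | x ≟ v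
... | yes x≡u | _       = inj₁ x≡u
... | no _    | yes x≡v = inj₂ (inj₁ x≡v)
... | no x≢u  | no x≢v  = inj₂ (inj₂ (x≢u , x≢v))

h-[]-swap : u ≢ v → ∀ x → h u v [ x ] ≡ swap01 (h v u [ x ])
h-[]-swap {u = u} {v} u≢v x with letter-cases u v x
... | inj₁ refl               rewrite h-[u] x v | h-[v] (≢-sym u≢v) = refl
... | inj₂ (inj₁ refl)        rewrite h-[u] x u | h-[v] u≢v = refl
... | inj₂ (inj₂ (x≢u , x≢v)) rewrite h-[x] x≢u x≢v | h-[x] x≢v x≢u = refl

h-swap : u ≢ v → ∀ xs → h u v xs ≡ swap01 (h v u xs)
h-swap u≢v [] = refl
h-swap {u = u} {v} u≢v (x ∷ xs) = begin
  h u v (x ∷ xs)                             ≡⟨ h-∷ u v x xs ⟩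
  h u v [ x ] ++ h u v xs                    ≡⟨ cong₂ _++_ (h-[]-swap u≢v x) (h-swap u≢v xs) ⟩
  swap01 (h v u [ x ]) ++ swap01 (h v u xs) ≡⟨ map-++ not (h v u [ x ]) (h v u xs) ⟨
  swap01 (h v u [ x ] ++ h v u xs)           ≡⟨ cong swap01 (h-∷ v u x xs) ⟨
  swap01 (h v u (x ∷ xs))                    ∎
  where open ≡-Reasoning

h-[]-ones : x ≢ u → All (_≡ true) (h u v [ x ])
h-[]-ones {x = x} {u} {v} x≢u with letter-cases u v x
... | inj₁ x≡u              = contradiction x≡u x≢u
... | inj₂ (inj₁ refl)      rewrite h-[v] (≢-sym x≢u) = refl ∷ []
... | inj₂ (inj₂ (_ , x≢v)) rewrite h-[x] x≢u x≢v = []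

h-ones : ∀ (u v : Fin n) {xs} → All (_≢ u) xs → All (_≡ true) (h u v xs)
h-ones u v []                        = []
h-ones u v {x ∷ xs} (x≢u ∷ xs≢u) rewrite h-∷ u v x xs = ++⁺ (h-[]-ones x≢u) (h-ones u v xs≢u)

h-∈ : u ≢ v → v ∈ xs → true ∈ h u v xs
h-∈ {u = u} {v} {v ∷ xs} u≢v (here refl)  rewrite h-∷ u v v xs | h-[v] u≢v = here refl
h-∈ {u = u} {v} {x ∷ xs} u≢v (there v∈xs) rewrite h-∷ u v x xs = ∈-++⁺ʳ (h u v [ x ]) (h-∈ u≢v v∈xs)

h-absent : All (λ x → x ≢ u × x ≢ v) xs → h u v xs ≡ []
h-absent []                                      = refl
h-absent {u = u} {v} {x ∷ xs} ((x≢u , x≢v) ∷ ps) =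
  trans (h-∷ u v x xs) (cong₂ _++_ (h-[x] x≢u x≢v) (h-absent ps))

∈⇒occursIn : ∀ {A : Set} {a : A} {as} → a ∈ as → a occursIn as
∈⇒occursIn (here refl)  = here
∈⇒occursIn (there a∈as) = there (∈⇒occursIn a∈as)

length-filterᵇ : ∀ {A : Set} (p : A → Bool) as →
                 length (filterᵇ p as) ≡ sum (map (λ a → if p a then 1 else 0) as)
length-filterᵇ p []       = refl
length-filterᵇ p (a ∷ as) with p a
... | true  = cong suc (length-filterᵇ p as)
... | false = length-filterᵇ p as

allFin-suc : allFin (suc n) ≡ zero ∷ map suc (allFin n)
allFin-suc = cong (zero ∷_) (sym (map-tabulate id suc))

allFin-split : ∀ (u : Fin n) → ∃₂ λ as bs → allFin n ≡ as ++ u ∷ bs × All (_< u) as × All (u <_) bs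
allFin-split {suc n} zero =
  [] , map suc (allFin n) , allFin-suc , [] , AllP.map⁺ (All.universal (λ _ → z<s) _)
allFin-split {suc n} (suc u) with allFin-split u
... | as , bs , allFin≡ , as<u , u<bs =
  zero ∷ map suc as , map suc bs ,
  trans allFin-suc (cong (zero ∷_) (trans (cong (map suc) allFin≡) (map-++ suc as (u ∷ bs)))) ,
  z<s ∷ AllP.map⁺ (All.map s<s as<u) , AllP.map⁺ (All.map s<s u<bs)

∈-after : ∀ {as bs} → All (_< u) as → u < v → v ∈ as ++ u ∷ bs → v ∈ bs
∈-after {as = as} as<u u<v v∈ with ∈-++⁻ as v∈
... | inj₁ v∈as         = contradiction (All.lookup as<u v∈as) (<-asym u<v)
... | inj₂ (here refl)  = contradiction u<v (<-irrefl refl)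
... | inj₂ (there v∈bs) = v∈bs

module Construction (adj : Fin n → Fin n → Bool) where

  -- The summand of edgeCount, so that length-word needs no conversion.
  upEdge : Fin n → Fin n → Bool
  upEdge u v = (toℕ u <ᵇ toℕ v) ∧ adj u v

  upNeighbours : Fin n → List (Fin n)
  upNeighbours u = filterᵇ (upEdge u) (allFin n)

  block : Fin n → List (Fin n)
  block u = u ∷ upNeighbours u ++ [ u ]

  blocks : List (Fin n) → List (Fin n)
  blocks = concatMap block

  word : List (Fin n)
  word = blocks (allFin n)

  upEdge⇒< : T (upEdge u v) → u < v
  upEdge⇒< {u = u} {v} e = <ᵇ⇒< (toℕ u) (toℕ v) (proj₁ (Equivalence.to T-∧ e))

  upEdge⇒adj : T (upEdge u v) → adj u v ≡ true
  upEdge⇒adj e = Equivalence.to T-≡ (proj₂ (Equivalence.to T-∧ e))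

  upNeighbours-upEdge : ∀ u → All (T ∘ upEdge u) (upNeighbours u)
  upNeighbours-upEdge u = AllP.all-filter (T? ∘ upEdge u) (allFin n)

  upNeighbours-≢ : ∀ u → All (_≢ u) (upNeighbours u)
  upNeighbours-≢ u = All.map (≢-sym ∘ <⇒≢ ∘ upEdge⇒<) (upNeighbours-upEdge u)

  ∈-upNeighbours : u < v → adj u v ≡ true → v ∈ upNeighbours u
  ∈-upNeighbours {u = u} {v} u<v uv =
    ∈-filter⁺ (T? ∘ upEdge u) (∈-allFin v) (Equivalence.from T-∧ (<⇒<ᵇ u<v , Equivalence.from T-≡ uv))

  blocks-above : ∀ {u : Fin n} {bs} → All (u <_) bs → All (u <_) (blocks bs)
  blocks-above = AllP.concat⁺ ∘ AllP.map⁺ ∘ All.map block-above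
    where
    block-above : ∀ {u b : Fin n} → u < b → All (u <_) (block b)
    block-above {b = b} u<b =
      u<b ∷ ++⁺ (All.map (<-trans u<b ∘ upEdge⇒<) (upNeighbours-upEdge b)) (u<b ∷ [])

  ∈-blocks : ∀ {bs} → v ∈ bs → v ∈ blocks bs
  ∈-blocks = ∈-concatMap⁺ block ∘ Any.map (λ { refl → here refl })

  h-upNeighbours-adjacent : u < v → adj u v ≡ true → Ones⁺ (h u v (upNeighbours u))
  h-upNeighbours-adjacent {u = u} {v} u<v uv =
    h-ones u v (upNeighbours-≢ u) , h-∈ (<⇒≢ u<v) (∈-upNeighbours u<v uv)

  h-upNeighbours-nonadjacent : adj u v ≡ false → h u v (upNeighbours u) ≡ []
  h-upNeighbours-nonadjacent {u = u} {v} uv =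
    h-absent (All.zip (upNeighbours-≢ u , All.map ≢v (upNeighbours-upEdge u)))
    where
    ≢v : ∀ {y} → T (upEdge u y) → y ≢ v
    ≢v e refl = contradiction (trans (sym uv) (upEdge⇒adj e)) λ ()

  h-word-shape : u < v →
    ∃₂ λ x z → h u v word ≡ x ++ false ∷ h u v (upNeighbours u) ++ false ∷ z × Ones⁺ z
  h-word-shape {u = u} {v} u<v with allFin-split u
  ... | as , bs , allFin≡ , as<u , u<bs =
    h u v (blocks as) , h u v (blocks bs) , shape ,
    h-ones u v (All.map (≢-sym ∘ <⇒≢) (blocks-above u<bs)) ,
    h-∈ (<⇒≢ u<v) (∈-blocks (∈-after as<u u<v (subst (v ∈_) allFin≡ (∈-allFin v))))
    where
    open ≡-Reasoning
    ups = upNeighbours u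
    shape : h u v word ≡ h u v (blocks as) ++ false ∷ h u v ups ++ false ∷ h u v (blocks bs)
    shape = begin
      h u v (blocks (allFin n))                 ≡⟨ cong (h u v ∘ blocks) allFin≡ ⟩
      h u v (blocks (as ++ u ∷ bs))             ≡⟨ cong (h u v) (concatMap-++ block as (u ∷ bs)) ⟩
      h u v (blocks as ++ block u ++ blocks bs) ≡⟨ h-++ u v (blocks as) _ ⟩
      h u v (blocks as) ++ h u v (u ∷ (ups ++ [ u ]) ++ blocks bs)
        ≡⟨ cong (λ t → h u v (blocks as) ++ h u v (u ∷ t)) (++-assoc ups [ u ] (blocks bs)) ⟩
      h u v (blocks as) ++ h u v (u ∷ ups ++ u ∷ blocks bs)
        ≡⟨ cong (h u v (blocks as) ++_) (h-u∷ u v (ups ++ u ∷ blocks bs)) ⟩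
      h u v (blocks as) ++ false ∷ h u v (ups ++ u ∷ blocks bs)
        ≡⟨ cong (λ t → h u v (blocks as) ++ false ∷ t) (h-++ u v ups (u ∷ blocks bs)) ⟩
      h u v (blocks as) ++ false ∷ h u v ups ++ h u v (u ∷ blocks bs)
        ≡⟨ cong (λ t → h u v (blocks as) ++ false ∷ h u v ups ++ t) (h-u∷ u v (blocks bs)) ⟩
      h u v (blocks as) ++ false ∷ h u v ups ++ false ∷ h u v (blocks bs) ∎

  accepts-word-< : u < v → accepts (h u v word) ≡ adj u v
  accepts-word-< {u = u} {v} u<v with h-word-shape u<v | adj u v in uv
  ... | x , z , shape , z∈1⁺ | true  rewrite shape =
    accepts-01⁺01⁺ x (h-upNeighbours-adjacent u<v uv) z∈1⁺
  ... | x , z , shape , z∈1⁺ | false rewrite shape | h-upNeighbours-nonadjacent uv =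
    rejects-001⁺ x z∈1⁺

  accepts-word : (∀ u v → adj u v ≡ adj v u) → u ≢ v → accepts (h u v word) ≡ adj u v
  accepts-word {u = u} {v} adj-sym u≢v with <-cmp u v
  ... | tri< u<v _ _ = accepts-word-< u<v
  ... | tri≈ _ u≡v _ = contradiction u≡v u≢v
  ... | tri> _ _ v<u = begin
    accepts (h u v word)          ≡⟨ cong accepts (h-swap u≢v word) ⟩
    accepts (swap01 (h v u word)) ≡⟨ accepts-swap01 (h v u word) ⟩
    accepts (h v u word)          ≡⟨ accepts-word-< v<u ⟩
    adj v u                       ≡⟨ adj-sym v u ⟩
    adj u v                       ∎
    where open ≡-Reasoning

  word-represents : (∀ u v → adj u v ≡ adj v u) → Represents Lang word adj
  word-represents adj-sym =
    (λ v → ∈⇒occursIn (∈-blocks (∈-allFin v))) ,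
    (λ u v u≢v → let accepts≡adj = accepts-word adj-sym u≢v in
                 mk⇔ (trans accepts≡adj) (trans (sym accepts≡adj)))

  upIndicators : Fin n → List ℕ
  upIndicators u = map (λ v → if upEdge u v then 1 else 0) (allFin n)

  length-blocks : ∀ bs → length (blocks bs) ≡ 2 * length bs + sum (concatMap upIndicators bs)
  length-blocks []       = refl
  length-blocks (b ∷ bs) = begin
    length (block b ++ blocks bs)
      ≡⟨ length-++ (block b) ⟩
    suc (length (upNeighbours b ++ [ b ])) + length (blocks bs)
      ≡⟨ cong₂ (λ k l → suc k + l) (length-++ (upNeighbours b)) (length-blocks bs) ⟩
    suc (length (upNeighbours b) + 1) + (2 * length bs + sum (concatMap upIndicators bs))
      ≡⟨ cong (λ k → suc (k + 1) + _) (length-filterᵇ (upEdge b) (allFin n)) ⟩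
    suc (sum (upIndicators b) + 1) + (2 * length bs + sum (concatMap upIndicators bs))
      ≡⟨ rearrange (sum (upIndicators b)) (length bs) (sum (concatMap upIndicators bs)) ⟩
    2 * suc (length bs) + (sum (upIndicators b) + sum (concatMap upIndicators bs))
      ≡⟨ cong (2 * suc (length bs) +_) (sum-++ (upIndicators b) (concatMap upIndicators bs)) ⟨
    2 * suc (length bs) + sum (concatMap upIndicators (b ∷ bs)) ∎
    where
    open ≡-Reasoning
    rearrange : ∀ k l m → suc (k + 1) + (2 * l + m) ≡ 2 * suc l + (k + m)
    rearrange = solve-∀

  length-word : length word ≤ 2 * (n + edgeCount n adj)
  length-word = begin
    length word               ≡⟨ length-blocks (allFin n) ⟩
    2 * length (allFin n) + m ≡⟨ cong (λ k → 2 * k + m) (length-tabulate {n = n} id) ⟩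
    2 * n + m                 ≤⟨ +-monoʳ-≤ (2 * n) (m≤n*m m 2) ⟩
    2 * n + 2 * m             ≡⟨ *-distribˡ-+ 2 n m ⟨
    2 * (n + m)               ∎
    where
    open ≤-Reasoning
    m = edgeCount n adj

mainTheorem14 : Σ[ L ∈ Language ] (Symmetric01 L ×
                  Σ[ C ∈ ℕ ] (∀ (n : ℕ) → 1 ≤ n → (adj : Fin n → Fin n → Bool) → IsSimpleGraph adj →
                    Σ[ w ∈ List (Fin n) ] (Represents L w adj × length w ≤ C * (n + edgeCount n adj))))
mainTheorem14 = Lang , Lang-symmetric01 , 2 , λ n _ adj (adj-sym , _) →
  let open Construction adj in word , word-represents adj-sym , length-word
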